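{- Let $n>3$ be an integer and $k$ an integer with $3\leq k\leq n$. Then $$\frac{n!}{(k-1)n}\leq \mathcal{C}(n,k)\leq \frac{2^n\, n!}{k-1}.$$
   Context: For a permutation $\sigma=a_1\cdots a_n$ of $\{1,\dots,n\}$, position $j$ is a record position if $a_i<a_j$ for all $i<j$. $\mathcal{C}(n,k)$ denotes the number of permutations of $\{1,\dots,n\}$ whose record positions sum to $k$. Standing assumption in this part of the paper: $n$ is an integer greater than $3$. -}

module Defs where

open import Data.Nat using (ℕ; zero; suc; _+_; _<ᵇ_)
open import Data.Bool using (if_then_else_)


open import Data.List using (List; []; _∷_; _++_; [_]; map; upTo; length; foldr)
open import Data.Bool using (Bool; true; _∧_)
open import Data.List.Membership.Propositional using (_∈_)
open import Data.List.Relation.Binary.Permutation.Propositional using (_↭_)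
open import Data.Product using (_×_)
open import Relation.Binary.PropositionalEquality using (_≡_)
open import Function.Bundles using (_⇔_)

allᵇ : (ℕ → Bool) → List ℕ → Bool
allᵇ p = foldr (λ b r → p b ∧ r) true

oneTo : ℕ → List ℕ
oneTo n = map suc (upTo n)

IsPerm : ℕ → List ℕ → Set
IsPerm n xs = xs ↭ oneTo n

-- recordSumFrom j pre rest : the current position is j (1-indexed),
-- pre = a₁⋯a_{j-1}, rest = a_j⋯aₙ.  Position j is a record position iff
-- every earlier entry is smaller than a_j.
recordSumFrom : ℕ → List ℕ → List ℕ → ℕ
recordSumFrom j pre []         = 0
recordSumFrom j pre (a ∷ rest) =
  (if allᵇ (λ b → b <ᵇ a) pre then j else 0) + recordSumFrom (suc j) (pre ++ [ a ]) rest

recordSum : List ℕ → ℕ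
recordSum xs = recordSumFrom 1 [] xs

-- L enumerates (each exactly once, see Unique in the statement) the
-- permutations of {1,...,n} whose record positions sum to k;
-- thus length L = C(n,k).
Enumerates-C : ℕ → ℕ → List (List ℕ) → Set
Enumerates-C n k L = ∀ xs → (xs ∈ L) ⇔ (IsPerm n xs × recordSum xs ≡ k)

-- Upper bound: C(n,k) ≤ n! and k − 1 ≤ n < 2ⁿ.
-- Lower bound, with n = m + 1 and k = c + 3: in a permutation τ of {1,…,m}, move the
-- largest of the first c + 1 entries to the front and insert n at position c + 2.  The
-- records of the result are exactly the positions 1 and c + 2, so it is counted by
-- C(n,k), and τ is recovered from it together with the original position of the moved
-- entry, one of c + 1 values.  Hence m! ≤ (c + 1)·C(n,k).
module Submission where

open import Defs
open import Data.Bool using (true; false; if_then_else_)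
open import Data.Bool.Properties using (∧-zeroʳ)
open import Data.List using (List; []; _∷_; _++_; [_]; map; concatMap; length; upTo; take; drop)
open import Data.List.Extrema.Nat using (max; argmax-sel; ⊥≤max; xs≤max)
open import Data.List.Membership.Propositional using (_∈_; find; lose)
open import Data.List.Membership.Propositional.Properties
  using (∈-map⁺; ∈-map⁻; ∈-concatMap⁺; ∈-concatMap⁻; ∈-∃++; ∈-++⁻; ∈-++⁺ˡ; ∈-++⁺ʳ; ∈-upTo⁺; ∈-upTo⁻)
open import Data.List.Properties
  using (length-++; length-map; length-upTo; length-take; map-∘; map-++; ++-assoc; ++-identityʳ;
         take++drop≡id; upTo-∷ʳ; ∷-injectiveˡ; ∷-injectiveʳ)
open import Data.List.Relation.Binary.Permutation.Propositional
  using (_↭_; ↭-refl; ↭-reflexive; ↭-sym; ↭-trans; ↭-prep; ↭-swap; ↭⇒↭ₛ)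
import Data.List.Relation.Binary.Permutation.Setoid.Properties as PermSetoid
open import Data.List.Relation.Binary.Permutation.Propositional.Properties
  using (↭-length; ↭-empty-inv; ∈-resp-↭; All-resp-↭; shift; drop-mid; ∷↭∷ʳ)
open import Data.List.Relation.Binary.Subset.Propositional using (_⊆_)
open import Data.List.Relation.Binary.Disjoint.Propositional using (Disjoint)
open import Data.List.Relation.Unary.All as All using (All; []; _∷_)
open import Data.List.Relation.Unary.All.Properties as All using ()
open import Data.List.Relation.Unary.AllPairs as AllPairs using ([]; _∷_)
import Data.List.Relation.Unary.AllPairs.Properties as AllPairs
open import Data.List.Relation.Unary.Any using (here; there)
open import Data.List.Relation.Unary.Unique.Propositional using (Unique)
import Data.List.Relation.Unary.Unique.Propositional.Properties as Unique
open import Data.Nat using (ℕ; zero; suc; _+_; _*_; _∸_; _^_; _≤_; _<_; _!; s≤s; z≤n; z<s; _<ᵇ_)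
open import Data.Nat.Properties
open import Data.Product using (∃; ∃₂; _×_; _,_; proj₁; proj₂; map₂)
open import Data.Sum using (inj₁; inj₂)
open import Data.Empty using (⊥-elim)
open import Function using (_∘_; id; case_of_)
open import Function.Bundles using (Equivalence)
open import Relation.Binary.PropositionalEquality
  using (_≡_; _≢_; refl; sym; trans; cong; cong₂; subst; setoid; module ≡-Reasoning)

private
  variable
    A B : Set

length-concatMap : ∀ (f : A → List B) d xs → (∀ {x} → x ∈ xs → length (f x) ≡ d) →
                   length (concatMap f xs) ≡ length xs * d
length-concatMap f d []       _   = refl
length-concatMap f d (x ∷ xs) len = begin
  length (f x ++ concatMap f xs)            ≡⟨ length-++ (f x) ⟩
  length (f x) + length (concatMap f xs)    ≡⟨ cong₂ _+_ (len (here refl)) (length-concatMap f d xs (len ∘ there)) ⟩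
  d + length xs * d                         ∎
  where open ≡-Reasoning

length-++-∷ : ∀ (as : List A) {x bs} → length (as ++ x ∷ bs) ≡ suc (length (as ++ bs))
length-++-∷ []       = refl
length-++-∷ (a ∷ as) = cong suc (length-++-∷ as)

Unique⇒length≤ : ∀ {xs ys : List A} → Unique xs → xs ⊆ ys → length xs ≤ length ys
Unique⇒length≤ {xs = []}     _             _   = z≤n
Unique⇒length≤ {xs = x ∷ xs} (x∉xs ∷ !xs) sub with ∈-∃++ (sub (here refl))
... | as , bs , refl = begin
  suc (length xs)          ≤⟨ s≤s (Unique⇒length≤ !xs sub′) ⟩
  suc (length (as ++ bs))  ≡⟨ length-++-∷ as ⟨
  length (as ++ x ∷ bs)    ∎
  where
  open ≤-Reasoning
  sub′ : xs ⊆ as ++ bs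
  sub′ w∈xs with ∈-++⁻ as (sub (there w∈xs))
  ... | inj₁ w∈as         = ∈-++⁺ˡ w∈as
  ... | inj₂ (here refl)  = ⊥-elim (All.lookup x∉xs w∈xs refl)
  ... | inj₂ (there w∈bs) = ∈-++⁺ʳ as w∈bs

length≤-cover : ∀ (f : B → ℕ → A) d {xs ys} → Unique xs →
                (∀ {x} → x ∈ xs → ∃₂ λ y i → y ∈ ys × i < d × x ≡ f y i) →
                length xs ≤ length ys * d
length≤-cover f d {xs} {ys} !xs cover = begin
  length xs                    ≤⟨ Unique⇒length≤ !xs covered ⟩
  length (concatMap fibre ys)  ≡⟨ length-concatMap fibre d ys (λ _ → length-fibre) ⟩
  length ys * d                ∎
  where
  open ≤-Reasoning
  fibre : _ → List _
  fibre y = map (f y) (upTo d)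
  length-fibre : ∀ {y} → length (fibre y) ≡ d
  length-fibre = trans (length-map _ (upTo d)) (length-upTo d)
  covered : xs ⊆ concatMap fibre ys
  covered x∈xs with cover x∈xs
  ... | y , i , y∈ys , i<d , refl = ∈-concatMap⁺ fibre (lose y∈ys (∈-map⁺ (f y) (∈-upTo⁺ i<d)))

select : List A → List (A × List A)
select []       = []
select (y ∷ ys) = (y , ys) ∷ map (map₂ (y ∷_)) (select ys)

∈-select⁻ : ∀ (ys : List A) {z r} → (z , r) ∈ select ys → ys ↭ z ∷ r
∈-select⁻ (y ∷ ys) (here refl) = ↭-refl
∈-select⁻ (y ∷ ys) (there p) with ∈-map⁻ (map₂ (y ∷_)) p
... | (z , r) , q , refl = ↭-trans (↭-prep y (∈-select⁻ ys q)) (↭-swap y z ↭-refl)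

∈-select⁺ : ∀ (as : List A) x bs → (x , as ++ bs) ∈ select (as ++ x ∷ bs)
∈-select⁺ []       x bs = here refl
∈-select⁺ (a ∷ as) x bs = there (∈-map⁺ (map₂ (a ∷_)) (∈-select⁺ as x bs))

map-proj₁-select : ∀ (ys : List A) → map proj₁ (select ys) ≡ ys
map-proj₁-select []       = refl
map-proj₁-select (y ∷ ys) = cong (y ∷_) (trans (sym (map-∘ (select ys))) (map-proj₁-select ys))

length-select : ∀ (ys : List A) → length (select ys) ≡ length ys
length-select ys = trans (sym (length-map proj₁ (select ys))) (cong length (map-proj₁-select ys))

-- The index m is fuel: the lemmas below assume length ys ≡ m.
permutations : ℕ → List A → List (List A)
permutations zero    _  = [ [] ]
permutations (suc m) ys = concatMap (λ (z , r) → map (z ∷_) (permutations m r)) (select ys)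

∈-permutations⁻ : ∀ m {ys xs : List A} → length ys ≡ m → xs ∈ permutations m ys → xs ↭ ys
∈-permutations⁻ zero    {[]} _   (here refl) = ↭-refl
∈-permutations⁻ (suc m) {ys} len p with find (∈-concatMap⁻ _ {xs = select ys} p)
... | (z , r) , zr∈ , q with ∈-map⁻ (z ∷_) q
... | xs , xs∈ , refl = ↭-trans (↭-prep z (∈-permutations⁻ m len′ xs∈)) (↭-sym ys↭zr)
  where
  ys↭zr = ∈-select⁻ ys zr∈
  len′ = suc-injective (trans (sym (↭-length ys↭zr)) len)

∈-permutations⁺ : ∀ m {ys xs : List A} → length ys ≡ m → xs ↭ ys → xs ∈ permutations m ys
∈-permutations⁺ zero    {[]} _ p rewrite ↭-empty-inv p = here refl
∈-permutations⁺ (suc m) {ys} {[]} len p with () ← trans (↭-length p) len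
∈-permutations⁺ (suc m) {ys} {x ∷ xs} len p with ∈-∃++ (∈-resp-↭ p (here refl))
... | as , bs , refl =
  ∈-concatMap⁺ _ (lose (∈-select⁺ as x bs) (∈-map⁺ (x ∷_) (∈-permutations⁺ m len′ (drop-mid [] as p))))
  where len′ = suc-injective (trans (sym (length-++-∷ as)) len)

length-permutations : ∀ m (ys : List A) → length ys ≡ m → length (permutations m ys) ≡ m !
length-permutations zero    _  _   = refl
length-permutations (suc m) ys len =
  trans (length-concatMap _ (m !) (select ys) length-block)
        (cong (_* m !) (trans (length-select ys) len))
  where
  length-block : ∀ {zr} → zr ∈ select ys → length (map (proj₁ zr ∷_) (permutations m (proj₂ zr))) ≡ m !
  length-block {z , r} zr∈ = trans (length-map _ (permutations m r))
    (length-permutations m r (suc-injective (trans (sym (↭-length (∈-select⁻ ys zr∈))) len)))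

Disjoint-∷ : ∀ {z z′ : A} {xss yss} → z ≢ z′ → Disjoint (map (z ∷_) xss) (map (z′ ∷_) yss)
Disjoint-∷ z≢z′ (p , q) with ∈-map⁻ _ p | ∈-map⁻ _ q
... | _ , _ , refl | _ , _ , eq = z≢z′ (∷-injectiveˡ eq)

permutations-unique : ∀ m {ys : List A} → Unique ys → Unique (permutations m ys)
permutations-unique zero    _   = [] ∷ []
permutations-unique (suc m) {ys} !ys =
  Unique.concat⁺ (All.map⁺ (All.tabulate unique-block))
                 (AllPairs.map⁺ (AllPairs.map Disjoint-∷ (AllPairs.map⁻ !heads)))
  where
  !heads : Unique (map proj₁ (select ys))
  !heads = subst Unique (sym (map-proj₁-select ys)) !ys
  unique-block : ∀ {zr} → zr ∈ select ys → Unique (map (proj₁ zr ∷_) (permutations m (proj₂ zr)))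
  unique-block zr∈ with PermSetoid.Unique-resp-↭ (setoid _) (↭⇒↭ₛ (∈-select⁻ ys zr∈)) !ys
  ... | _ ∷ !r = Unique.map⁺ ∷-injectiveʳ (permutations-unique m !r)

allᵇ-<ᵇ-true : ∀ {a} pre → All (_< a) pre → allᵇ (λ b → b <ᵇ a) pre ≡ true
allᵇ-<ᵇ-true []        []          = refl
allᵇ-<ᵇ-true {a} (b ∷ pre) (b<a ∷ pre<a) with b <ᵇ a | <⇒<ᵇ b<a
... | true | _ = allᵇ-<ᵇ-true pre pre<a

allᵇ-<ᵇ-false : ∀ {a z} pre → z ∈ pre → a ≤ z → allᵇ (λ b → b <ᵇ a) pre ≡ false
allᵇ-<ᵇ-false {a} (b ∷ pre) (here refl) a≤b with b <ᵇ a | <ᵇ⇒< b a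
... | false | _   = refl
... | true  | b<a = ⊥-elim (≤⇒≯ a≤b (b<a _))
allᵇ-<ᵇ-false {a} (b ∷ pre) (there z∈pre) a≤z
  rewrite allᵇ-<ᵇ-false pre z∈pre a≤z = ∧-zeroʳ (b <ᵇ a)

recordSumFrom-dominated : ∀ {z} j pre g l → z ∈ pre → All (_≤ z) g →
  recordSumFrom j pre (g ++ l) ≡ recordSumFrom (length g + j) (pre ++ g) l
recordSumFrom-dominated j pre [] l _ [] rewrite ++-identityʳ pre = refl
recordSumFrom-dominated j pre (a ∷ g) l z∈pre (a≤z ∷ g≤z)
  rewrite allᵇ-<ᵇ-false pre z∈pre a≤z = begin
  recordSumFrom (suc j) (pre ++ [ a ]) (g ++ l)
    ≡⟨ recordSumFrom-dominated (suc j) (pre ++ [ a ]) g l (∈-++⁺ˡ z∈pre) g≤z ⟩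
  recordSumFrom (length g + suc j) ((pre ++ [ a ]) ++ g) l
    ≡⟨ cong₂ (λ i p → recordSumFrom i p l) (+-suc (length g) j) (++-assoc pre [ a ] g) ⟩
  recordSumFrom (suc (length g + j)) (pre ++ a ∷ g) l
    ∎
  where open ≡-Reasoning

recordSum-two-records : ∀ {x v} g back → All (_≤ x) g → All (_< v) (x ∷ g) → All (_≤ v) back →
  recordSum (x ∷ g ++ v ∷ back) ≡ 3 + length g
recordSum-two-records {x} {v} g back g≤x x∷g<v back≤v = begin
  1 + recordSumFrom 2 [ x ] (g ++ v ∷ back)
    ≡⟨ cong (1 +_) (recordSumFrom-dominated 2 [ x ] g (v ∷ back) (here refl) g≤x) ⟩
  1 + recordSumFrom (length g + 2) (x ∷ g) (v ∷ back)
    ≡⟨ cong (λ b → 1 + ((if b then length g + 2 else 0) + records-in-back)) (allᵇ-<ᵇ-true (x ∷ g) x∷g<v) ⟩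
  1 + (length g + 2 + records-in-back)
    ≡⟨ cong (λ r → 1 + (length g + 2 + r)) no-records-in-back ⟩
  1 + (length g + 2 + 0)
    ≡⟨ cong suc (trans (+-identityʳ (length g + 2)) (+-comm (length g) 2)) ⟩
  3 + length g
    ∎
  where
  open ≡-Reasoning
  records-in-back : ℕ
  records-in-back = recordSumFrom (suc (length g + 2)) (x ∷ g ++ [ v ]) back
  no-records-in-back : records-in-back ≡ 0
  no-records-in-back = trans
    (cong (recordSumFrom _ _) (sym (++-identityʳ back)))
    (recordSumFrom-dominated _ _ back [] (∈-++⁺ʳ (x ∷ g) (here refl)) back≤v)

length-oneTo : ∀ m → length (oneTo m) ≡ m
length-oneTo m = trans (length-map suc (upTo m)) (length-upTo m)

oneTo-unique : ∀ m → Unique (oneTo m)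
oneTo-unique m = Unique.map⁺ suc-injective (Unique.upTo⁺ m)

oneTo-≤ : ∀ m → All (_≤ m) (oneTo m)
oneTo-≤ m = All.tabulate λ w∈ → case ∈-map⁻ suc w∈ of λ where (_ , i∈ , refl) → ∈-upTo⁻ i∈

∷-oneTo-↭ : ∀ m → suc m ∷ oneTo m ↭ oneTo (suc m)
∷-oneTo-↭ m = ↭-trans (∷↭∷ʳ (suc m) (oneTo m))
  (↭-reflexive (sym (trans (cong (map suc) (sym (upTo-∷ʳ m))) (map-++ suc (upTo m) [ m ]))))

insertAt : ℕ → A → List A → List A
insertAt zero    v xs       = v ∷ xs
insertAt (suc i) v []       = [ v ]
insertAt (suc i) v (x ∷ xs) = x ∷ insertAt i v xs

removeAt : ℕ → List A → List A
removeAt _       []       = []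
removeAt zero    (x ∷ xs) = xs
removeAt (suc i) (x ∷ xs) = x ∷ removeAt i xs

insertAt-length : ∀ (as : List A) v bs → insertAt (length as) v (as ++ bs) ≡ as ++ v ∷ bs
insertAt-length []       v bs = refl
insertAt-length (a ∷ as) v bs = cong (a ∷_) (insertAt-length as v bs)

removeAt-length : ∀ (as : List A) v bs → removeAt (length as) (as ++ v ∷ bs) ≡ as ++ bs
removeAt-length []       v bs = refl
removeAt-length (a ∷ as) v bs = cong (a ∷_) (removeAt-length as v bs)

-- Undoes the construction below: delete the entry at position c + 2, then
-- move the first entry to position i + 1.
unpeak : ℕ → ℕ → List A → List A
unpeak c i []       = []
unpeak c i (x ∷ xs) = insertAt i x (removeAt c xs)

split-≤ : ∀ n (xs : List A) → n ≤ length xs → ∃₂ λ pre post → xs ≡ pre ++ post × length pre ≡ n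
split-≤ n xs n≤ = take n xs , drop n xs , sym (take++drop≡id n xs) ,
                  trans (length-take n xs) (m≤n⇒m⊓n≡m n≤)

max-exists : ∀ (xs : List ℕ) → 0 < length xs → ∃ λ x → x ∈ xs × All (_≤ x) xs
max-exists (y ∷ f) _ = max y f , max∈ , ⊥≤max y f ∷ xs≤max y f
  where
  max∈ : max y f ∈ y ∷ f
  max∈ with argmax-sel id y f
  ... | inj₁ max≡y = here max≡y
  ... | inj₂ max∈f = there max∈f

-- The largest x of the first c + 1 entries of τ moved to the front; g holds the other
-- c of them and i is the original position of x.
record FrontMax (c : ℕ) (τ : List ℕ) : Set where
  field
    x              : ℕ
    g back         : List ℕ
    i              : ℕ
    g≤x            : All (_≤ x) g
    length-g       : length g ≡ c
    i<1+c          : i < suc c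
    ↭τ             : x ∷ g ++ back ↭ τ
    unpeak-inverse : ∀ v → unpeak c i (x ∷ g ++ v ∷ back) ≡ τ

frontMax : ∀ c τ → suc c ≤ length τ → FrontMax c τ
frontMax c τ 1+c≤τ with split-≤ (suc c) τ 1+c≤τ
... | pre , back , refl , length-pre with max-exists pre (subst (0 <_) (sym length-pre) z<s)
... | x , x∈pre , pre≤x with ∈-∃++ x∈pre
... | as , bs , refl = record
  { x              = x
  ; g              = as ++ bs
  ; back           = back
  ; i              = length as
  ; g≤x            = All.++⁺ (All.++⁻ˡ as pre≤x) (All.tail (All.++⁻ʳ as pre≤x))
  ; length-g       = length-g
  ; i<1+c          = s≤s (subst (length as ≤_) (trans (sym (length-++ as)) length-g) (m≤m+n _ _))
  ; ↭τ             = ↭-trans (↭-reflexive (cong (x ∷_) (++-assoc as bs back)))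
                             (↭-trans (↭-sym (shift x as (bs ++ back)))
                                      (↭-reflexive (sym (++-assoc as (x ∷ bs) back))))
  ; unpeak-inverse = unpeak-inverse
  }
  where
  open ≡-Reasoning
  length-g : length (as ++ bs) ≡ c
  length-g = suc-injective (trans (sym (length-++-∷ as)) length-pre)
  unpeak-inverse : ∀ v → unpeak c (length as) (x ∷ (as ++ bs) ++ v ∷ back) ≡ (as ++ x ∷ bs) ++ back
  unpeak-inverse v = begin
    insertAt (length as) x (removeAt c ((as ++ bs) ++ v ∷ back))
      ≡⟨ cong (λ k → insertAt (length as) x (removeAt k ((as ++ bs) ++ v ∷ back))) (sym length-g) ⟩
    insertAt (length as) x (removeAt (length (as ++ bs)) ((as ++ bs) ++ v ∷ back))
      ≡⟨ cong (insertAt (length as) x) (removeAt-length (as ++ bs) v back) ⟩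
    insertAt (length as) x ((as ++ bs) ++ back)
      ≡⟨ cong (insertAt (length as) x) (++-assoc as bs back) ⟩
    insertAt (length as) x (as ++ bs ++ back)
      ≡⟨ insertAt-length as x (bs ++ back) ⟩
    as ++ x ∷ bs ++ back
      ≡⟨ ++-assoc as (x ∷ bs) back ⟨
    (as ++ x ∷ bs) ++ back
      ∎

peak-↭ : ∀ {m x} g back → x ∷ g ++ back ↭ oneTo m → x ∷ g ++ suc m ∷ back ↭ oneTo (suc m)
peak-↭ {m} {x} g back ρ↭ =
  ↭-trans (shift (suc m) (x ∷ g) back) (↭-trans (↭-prep (suc m) ρ↭) (∷-oneTo-↭ m))

recordSum-peak : ∀ {m x} g back → All (_≤ x) g → x ∷ g ++ back ↭ oneTo m →
                 recordSum (x ∷ g ++ suc m ∷ back) ≡ 3 + length g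
recordSum-peak {m} {x} g back g≤x ρ↭ = recordSum-two-records g back g≤x
  (All.map s≤s (All.++⁻ˡ (x ∷ g) ρ≤m)) (All.map m≤n⇒m≤1+n (All.++⁻ʳ (x ∷ g) ρ≤m))
  where
  ρ≤m : All (_≤ m) (x ∷ g ++ back)
  ρ≤m = All-resp-↭ (↭-sym ρ↭) (oneTo-≤ m)

factorial≤C*[1+c] : ∀ {m c L} → suc c ≤ m → Enumerates-C (suc m) (3 + c) L → m ! ≤ length L * suc c
factorial≤C*[1+c] {m} {c} {L} 1+c≤m E = begin
  m !                                 ≡⟨ length-permutations m (oneTo m) (length-oneTo m) ⟨
  length (permutations m (oneTo m))   ≤⟨ length≤-cover (λ σ i → unpeak c i σ) (suc c)
                                           (permutations-unique m (oneTo-unique m)) cover ⟩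
  length L * suc c                    ∎
  where
  open ≤-Reasoning
  cover : ∀ {τ} → τ ∈ permutations m (oneTo m) → ∃₂ λ σ i → σ ∈ L × i < suc c × τ ≡ unpeak c i σ
  cover {τ} τ∈ = x ∷ g ++ suc m ∷ back , i , Equivalence.from (E _) (peak-↭ g back ρ↭ , sum) ,
                 i<1+c , sym (unpeak-inverse (suc m))
    where
    τ↭ = ∈-permutations⁻ m (length-oneTo m) τ∈
    open FrontMax (frontMax c τ (subst (suc c ≤_) (sym (trans (↭-length τ↭) (length-oneTo m)))
                                       1+c≤m))
    ρ↭ = ↭-trans ↭τ τ↭
    sum = trans (recordSum-peak g back g≤x ρ↭) (cong (3 +_) length-g)

C≤factorial : ∀ {n k L} → Unique L → Enumerates-C n k L → length L ≤ n !
C≤factorial {n} {L = L} !L E = begin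
  length L                            ≤⟨ Unique⇒length≤ !L L⊆permutations ⟩
  length (permutations n (oneTo n))   ≡⟨ length-permutations n (oneTo n) (length-oneTo n) ⟩
  n !                                 ∎
  where
  open ≤-Reasoning
  L⊆permutations : L ⊆ permutations n (oneTo n)
  L⊆permutations σ∈ = ∈-permutations⁺ n (length-oneTo n) (proj₁ (Equivalence.to (E _) σ∈))

n<2^n : ∀ n → n < 2 ^ n
n<2^n zero    = z<s
n<2^n (suc n) = +-mono-≤ (≤-trans z<s (n<2^n n)) (≤-trans (n<2^n n) (m≤m+n (2 ^ n) 0))

proposition4p6 : (n k : ℕ) → 3 < n → 3 ≤ k → k ≤ n →
    (L : List (List ℕ)) → Unique L → Enumerates-C n k L →
    (n ! ≤ length L * ((k ∸ 1) * n)) × (length L * (k ∸ 1) ≤ 2 ^ n * n !)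
proposition4p6 (suc m) (suc (suc (suc c))) _ (s≤s (s≤s (s≤s _))) (s≤s 2+c≤m) L !L E = lower , upper
  where
  open ≤-Reasoning
  lower : suc m ! ≤ length L * (suc (suc c) * suc m)
  lower = begin
    suc m * m !                       ≤⟨ *-monoʳ-≤ (suc m) (factorial≤C*[1+c] (≤-trans (n≤1+n (suc c)) 2+c≤m) E) ⟩
    suc m * (length L * suc c)        ≤⟨ *-monoʳ-≤ (suc m) (*-monoʳ-≤ (length L) (n≤1+n (suc c))) ⟩
    suc m * (length L * suc (suc c))  ≡⟨ *-comm (suc m) _ ⟩
    length L * suc (suc c) * suc m    ≡⟨ *-assoc (length L) _ _ ⟩
    length L * (suc (suc c) * suc m)  ∎
  upper : length L * suc (suc c) ≤ 2 ^ suc m * suc m !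
  upper = begin
    length L * suc (suc c)  ≤⟨ *-mono-≤ (C≤factorial !L E) (<⇒≤ (≤-<-trans (m≤n⇒m≤1+n 2+c≤m) (n<2^n (suc m)))) ⟩
    suc m ! * 2 ^ suc m     ≡⟨ *-comm (suc m !) _ ⟩
    2 ^ suc m * suc m !     ∎
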